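{- Let $k\geq 1$ and $1\leq r\leq 2^{k+1}-1$ be fixed integers, and let $f_{2^k,n}:=\sum_{j=0}^{n}\binom{n}{j}(-1)^{\binom{j}{2^k}}$. Then for all integers $\nu\geq\frac{1}{17}\cdot 2^{3k}$ we have \[(-1)^{\nu}f_{2^k,n}>0,\qquad\text{where } n=\nu\cdot 2^{k+1}+r-1.\]
   Context: Here $\binom{j}{m}=0$ for $0\le j<m$; $f_{2^k,n}$ is the value at $z=-1$ of $f_{2^k,n}(z)=\sum_{j=0}^{n}\binom{n}{j}z^{\binom{j}{2^k}}$. -}

module Defs where

open import Data.Nat using (ℕ; zero; suc; _^_)
open import Data.Nat.Combinatorics using (_C_)
open import Data.Integer using (ℤ; +_; -_; _+_; _*_; 1ℤ)

sgn : ℕ → ℤ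
sgn zero = 1ℤ
sgn (suc m) = - sgn m

sumTo : ℕ → (ℕ → ℤ) → ℤ
sumTo zero g = g 0
sumTo (suc n) g = sumTo n g + g (suc n)

fAtMinusOne : ℕ → ℕ → ℤ
fAtMinusOne m n = sumTo n (λ j → (+ (n C j)) * sgn (j C m))

f2k : ℕ → ℕ → ℤ
f2k k n = fAtMinusOne (2 ^ k) n

-- Modulo 2, C(j, 2^k) is the k-th binary digit of j, so f_{2^k,n} = Σ_j C(n,j) s(j) with
-- s(j) = (-1)^⌊j/2^k⌋.  Put B(n,t) = Σ_j C(n,j) s(j+t).  Pascal's rule gives
-- B(n+1,t) = B(n,t) + B(n,t+1), and s(x) = -s(y) whenever 2^(k+1) divides x+y+1, so pairing
-- j with n-j shows B(n,t) = 0 when 2^(k+1) divides c = n+2t+1.  Otherwise B(n,t) has the sign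
-- (-1)^⌊c/2^(k+1)⌋: by induction on n, the two terms of the recurrence for B(n+1,t) have
-- centres c and c+2, carry the sign of c+1 unless they vanish, and cannot both vanish
-- because 2^(k+1) ≥ 4.
-- For n = ν 2^(k+1) + r - 1 the centre is ν 2^(k+1) + r, whose sign is (-1)^ν.
module Submission where

open import Defs
open import Data.Nat using (ℕ; _≤_; _^_; _∸_; _+_; _*_)
open import Data.Integer using (ℤ; +_; +0) renaming (_<_ to _<ℤ_; _*_ to _*ℤ_)

open import Data.Nat using (zero; suc; _<_; z≤n; s≤s; ⌊_/2⌋; >-nonZero)
import Data.Nat.Properties as ℕ
open import Data.Nat.Divisibility
  using (_∣_; _∤_; _∣?_; ∣-trans; ∣m+n∣m⇒∣n; *-cancelˡ-∣; *-monoʳ-∣; m∣m*n; n∣m*n; ∣1⇒≡1; 1∣_; >⇒∤; ∣⇒≤)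
open import Data.Nat.Combinatorics using (_C_; nC1≡n; nCk≡nC[n∸k]; k>n⇒nCk≡0; nCk+nC[k+1]≡[n+1]C[k+1])
open import Data.Integer using (-_; 1ℤ; +[1+_]; -[1+_]; +<+) renaming (_+_ to _+ℤ_)
import Data.Integer.Properties as ℤ
import Algebra.Properties.CommutativeSemigroup ℤ.+-commutativeSemigroup as ℤ+
import Data.Nat.Tactic.RingSolver as ℕ-Solver
open import Data.Empty using (⊥-elim)
open import Relation.Nullary using (Dec; yes; no; contradiction)
open import Relation.Binary.PropositionalEquality

open ≡-Reasoning

sgn-double : ∀ m → sgn (m + m) ≡ 1ℤ
sgn-double zero = refl
sgn-double (suc m) rewrite ℕ.+-suc m m = trans (ℤ.neg-involutive (sgn (m + m))) (sgn-double m)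

sgn-+ : ∀ m n → sgn (m + n) ≡ sgn m *ℤ sgn n
sgn-+ zero n = sym (ℤ.*-identityˡ (sgn n))
sgn-+ (suc m) n = trans (cong -_ (sgn-+ m n)) (ℤ.neg-distribˡ-* (sgn m) (sgn n))

sgn-*-sgn : ∀ m → sgn m *ℤ sgn m ≡ 1ℤ
sgn-*-sgn m = trans (sym (sgn-+ m m)) (sgn-double m)

pascal : ∀ n k → suc n C suc k ≡ n C k + n C suc k
pascal n k = sym (nCk+nC[k+1]≡[n+1]C[k+1] n k)

C-suc-suc : ∀ x m → suc (suc x) C suc (suc m) ≡ (x C m + x C suc (suc m)) + (x C suc m + x C suc m)
C-suc-suc x m = begin
  suc (suc x) C suc (suc m)                            ≡⟨ pascal (suc x) (suc m) ⟩
  suc x C suc m + suc x C suc (suc m)                  ≡⟨ cong₂ _+_ (pascal x m) (pascal x (suc m)) ⟩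
  (x C m + x C suc m) + (x C suc m + x C suc (suc m))  ≡⟨ regroup (x C m) (x C suc m) (x C suc (suc m)) ⟩
  (x C m + x C suc (suc m)) + (x C suc m + x C suc m)  ∎
  where
  regroup : ∀ a b c → (a + b) + (b + c) ≡ (a + c) + (b + b)
  regroup = ℕ-Solver.solve-∀

sgn-C-suc-suc : ∀ x m → sgn (suc (suc x) C suc (suc m)) ≡ sgn (x C m) *ℤ sgn (x C suc (suc m))
sgn-C-suc-suc x m = begin
  sgn (suc (suc x) C suc (suc m))         ≡⟨ cong sgn (C-suc-suc x m) ⟩
  sgn ((a + c) + (b + b))                 ≡⟨ sgn-+ (a + c) (b + b) ⟩
  sgn (a + c) *ℤ sgn (b + b)              ≡⟨ cong (_*ℤ_ (sgn (a + c))) (sgn-double b) ⟩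
  sgn (a + c) *ℤ 1ℤ                       ≡⟨ ℤ.*-identityʳ (sgn (a + c)) ⟩
  sgn (a + c)                             ≡⟨ sgn-+ a c ⟩
  sgn a *ℤ sgn c                          ∎
  where
  a b c : ℕ
  a = x C m
  b = x C suc m
  c = x C suc (suc m)

-- Lucas' theorem modulo 2 for an even lower index.
sgn-C-double : ∀ x b → sgn (x C (b + b)) ≡ sgn (⌊ x /2⌋ C b)
sgn-C-double x zero = refl
sgn-C-double zero (suc b) = refl
sgn-C-double (suc zero) (suc b) =
  cong sgn (k>n⇒nCk≡0 (s≤s (ℕ.≤-trans (s≤s z≤n) (ℕ.m≤n+m (suc b) b))))
sgn-C-double (suc (suc x)) (suc b) = begin
  sgn (suc (suc x) C (suc b + suc b))           ≡⟨ cong (λ m → sgn (suc (suc x) C m)) (ℕ.+-suc (suc b) b) ⟩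
  sgn (suc (suc x) C suc (suc (b + b)))         ≡⟨ sgn-C-suc-suc x (b + b) ⟩
  sgn (x C (b + b)) *ℤ sgn (x C suc (suc (b + b)))
    ≡⟨ cong₂ _*ℤ_ (sgn-C-double x b)
                  (trans (cong (λ m → sgn (x C m)) (sym (ℕ.+-suc (suc b) b))) (sgn-C-double x (suc b))) ⟩
  sgn (h C b) *ℤ sgn (h C suc b)                ≡⟨ sgn-+ (h C b) (h C suc b) ⟨
  sgn (h C b + h C suc b)                       ≡⟨ cong sgn (pascal h b) ⟨
  sgn (suc h C suc b)                           ∎
  where
  h : ℕ
  h = ⌊ x /2⌋

-- (-1) to the power of the j-th binary digit of x.
digitSign : ℕ → ℕ → ℤ
digitSign zero x = sgn x
digitSign (suc j) x = digitSign j ⌊ x /2⌋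

double : ∀ c → 2 * c ≡ c + c
double c = cong (_+_ c) (ℕ.+-identityʳ c)

sgn-C-2^ : ∀ j x → sgn (x C 2 ^ j) ≡ digitSign j x
sgn-C-2^ zero x = cong sgn (nC1≡n x)
sgn-C-2^ (suc j) x =
  trans (cong (λ m → sgn (x C m)) (double (2 ^ j))) (trans (sgn-C-double x (2 ^ j)) (sgn-C-2^ j ⌊ x /2⌋))

digitSign-*-digitSign : ∀ j x → digitSign j x *ℤ digitSign j x ≡ 1ℤ
digitSign-*-digitSign zero x = sgn-*-sgn x
digitSign-*-digitSign (suc j) x = digitSign-*-digitSign j ⌊ x /2⌋

data Parity : ℕ → Set where
  even : ∀ a → Parity (a + a)
  odd  : ∀ a → Parity (suc (a + a))

parity : ∀ x → Parity x
parity zero = even 0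
parity (suc x) with parity x
... | even a = odd a
... | odd a = subst Parity (cong suc (ℕ.+-suc a a)) (even (suc a))

⌊a+a/2⌋≡a : ∀ a → ⌊ a + a /2⌋ ≡ a
⌊a+a/2⌋≡a a = sym (ℕ.n≡⌊n+n/2⌋ a)

⌊1+a+a/2⌋≡a : ∀ a → ⌊ suc (a + a) /2⌋ ≡ a
⌊1+a+a/2⌋≡a zero = refl
⌊1+a+a/2⌋≡a (suc a) rewrite ℕ.+-suc a a = cong suc (⌊1+a+a/2⌋≡a a)

⌊a+a+r/2⌋≡a+⌊r/2⌋ : ∀ a r → ⌊ a + a + r /2⌋ ≡ a + ⌊ r /2⌋
⌊a+a+r/2⌋≡a+⌊r/2⌋ zero r = refl
⌊a+a+r/2⌋≡a+⌊r/2⌋ (suc a) r rewrite ℕ.+-suc a a = cong suc (⌊a+a+r/2⌋≡a+⌊r/2⌋ a r)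

r<a+a⇒⌊r/2⌋<a : ∀ r a → r < a + a → ⌊ r /2⌋ < a
r<a+a⇒⌊r/2⌋<a zero (suc a) _ = s≤s z≤n
r<a+a⇒⌊r/2⌋<a (suc zero) (suc a) _ = s≤s z≤n
r<a+a⇒⌊r/2⌋<a (suc (suc r)) (suc a) (s≤s r<) rewrite ℕ.+-suc a a =
  s≤s (r<a+a⇒⌊r/2⌋<a r a (ℕ.≤-pred r<))

2^[1+j]∤odd : ∀ j c → 2 ^ suc j ∤ suc (c + c)
2^[1+j]∤odd j c 2^[1+j]∣odd = contradiction (∣1⇒≡1 (∣m+n∣m⇒∣n 2∣c+c+1 2∣c+c)) λ ()
  where
  2∣c+c+1 : 2 ∣ (c + c) + 1
  2∣c+c+1 = ∣-trans (m∣m*n (2 ^ j)) (subst (2 ^ suc j ∣_) (ℕ.+-comm 1 (c + c)) 2^[1+j]∣odd)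
  2∣c+c : 2 ∣ c + c
  2∣c+c = subst (2 ∣_) (double c) (m∣m*n c)

2^[1+j]∣c+c⇒2^j∣c : ∀ j c → 2 ^ suc j ∣ c + c → 2 ^ j ∣ c
2^[1+j]∣c+c⇒2^j∣c j c d = *-cancelˡ-∣ 2 (subst (2 ^ suc j ∣_) (sym (double c)) d)

2^j∣c⇒2^[1+j]∣c+c : ∀ j c → 2 ^ j ∣ c → 2 ^ suc j ∣ c + c
2^j∣c⇒2^[1+j]∣c+c j c d = subst (2 ^ suc j ∣_) (double c) (*-monoʳ-∣ 2 d)

-- The j-th digit changes from x to x + 1 only through a carry, i.e. when 2^j divides x + 1.
digitSign-suc : ∀ j x → 2 ^ j ∤ suc x → digitSign j (suc x) ≡ digitSign j x
digitSign-suc zero x ∤ = contradiction (1∣ suc x) ∤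
digitSign-suc (suc j) x ∤ with parity x
... | even a rewrite ⌊1+a+a/2⌋≡a a | ⌊a+a/2⌋≡a a = refl
... | odd a rewrite ⌊1+a+a/2⌋≡a a | ⌊a+a/2⌋≡a a =
  digitSign-suc j a λ d → ∤ (subst (2 ^ suc j ∣_) (cong suc (ℕ.+-suc a a)) (2^j∣c⇒2^[1+j]∣c+c j (suc a) d))

-- If 2^(j+1) divides x + y + 1 then y ≡ -1 - x modulo 2^(j+1), whose j-th digit is flipped.
digitSign-complement : ∀ j x y → 2 ^ suc j ∣ suc (x + y) → digitSign j x ≡ - digitSign j y
digitSign-complement-even-odd : ∀ j a b → 2 ^ suc j ∣ suc (a + a + suc (b + b)) →
                                digitSign j (a + a) ≡ - digitSign j (suc (b + b))

digitSign-complement j x y d with parity x | parity y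
... | even a | even b = ⊥-elim (2^[1+j]∤odd j (a + b) (subst (2 ^ suc j ∣_) (eq a b) d))
  where
  eq : ∀ a b → suc (a + a + (b + b)) ≡ suc ((a + b) + (a + b))
  eq = ℕ-Solver.solve-∀
... | odd a | odd b = ⊥-elim (2^[1+j]∤odd j (suc (a + b)) (subst (2 ^ suc j ∣_) (eq a b) d))
  where
  eq : ∀ a b → suc (suc (a + a) + suc (b + b)) ≡ suc (suc (a + b) + suc (a + b))
  eq = ℕ-Solver.solve-∀
... | even a | odd b = digitSign-complement-even-odd j a b d
... | odd a | even b = begin
  digitSign j (suc (a + a))          ≡⟨ ℤ.neg-involutive (digitSign j (suc (a + a))) ⟨
  - - digitSign j (suc (a + a))      ≡⟨ cong -_ (digitSign-complement-even-odd j b a d′) ⟨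
  - digitSign j (b + b)              ∎
  where
  d′ : 2 ^ suc j ∣ suc (b + b + suc (a + a))
  d′ = subst (2 ^ suc j ∣_) (cong suc (ℕ.+-comm (suc (a + a)) (b + b))) d

digitSign-complement-even-odd zero a b _ rewrite sgn-double a | sgn-double b = refl
digitSign-complement-even-odd (suc j) a b d rewrite ⌊a+a/2⌋≡a a | ⌊1+a+a/2⌋≡a b =
  digitSign-complement j a b (2^[1+j]∣c+c⇒2^j∣c (suc j) (suc (a + b)) (subst (2 ^ suc (suc j) ∣_) (eq a b) d))
  where
  eq : ∀ a b → suc (a + a + suc (b + b)) ≡ suc (a + b) + suc (a + b)
  eq = ℕ-Solver.solve-∀

digitSign-high : ∀ j ν r → r < 2 ^ j → digitSign j (ν * 2 ^ j + r) ≡ sgn ν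
digitSign-high zero ν (suc r) (s≤s ())
digitSign-high zero ν zero _ rewrite ℕ.*-identityʳ ν | ℕ.+-identityʳ ν = refl
digitSign-high (suc j) ν r r< = begin
  digitSign j ⌊ ν * (2 * 2 ^ j) + r /2⌋        ≡⟨ cong (λ m → digitSign j ⌊ m + r /2⌋) ν*2^[1+j] ⟩
  digitSign j ⌊ ν * 2 ^ j + ν * 2 ^ j + r /2⌋  ≡⟨ cong (digitSign j) (⌊a+a+r/2⌋≡a+⌊r/2⌋ (ν * 2 ^ j) r) ⟩
  digitSign j (ν * 2 ^ j + ⌊ r /2⌋)            ≡⟨ digitSign-high j ν ⌊ r /2⌋ ⌊r/2⌋<2^j ⟩
  sgn ν                                        ∎
  where
  ν*2^[1+j] : ν * (2 * 2 ^ j) ≡ ν * 2 ^ j + ν * 2 ^ j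
  ν*2^[1+j] = trans (cong (_*_ ν) (double (2 ^ j))) (ℕ.*-distribˡ-+ ν (2 ^ j) (2 ^ j))
  ⌊r/2⌋<2^j : ⌊ r /2⌋ < 2 ^ j
  ⌊r/2⌋<2^j = r<a+a⇒⌊r/2⌋<a r (2 ^ j) (subst (r <_) (double (2 ^ j)) r<)

sumTo-cong : ∀ n {g h : ℕ → ℤ} → (∀ j → j ≤ n → g j ≡ h j) → sumTo n g ≡ sumTo n h
sumTo-cong zero g≡h = g≡h 0 z≤n
sumTo-cong (suc n) g≡h =
  cong₂ _+ℤ_ (sumTo-cong n (λ j j≤n → g≡h j (ℕ.m≤n⇒m≤1+n j≤n))) (g≡h (suc n) ℕ.≤-refl)

sumTo-+ : ∀ n (g h : ℕ → ℤ) → sumTo n (λ j → g j +ℤ h j) ≡ sumTo n g +ℤ sumTo n h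
sumTo-+ zero g h = refl
sumTo-+ (suc n) g h rewrite sumTo-+ n g h = ℤ+.interchange (sumTo n g) (sumTo n h) (g (suc n)) (h (suc n))

sumTo-neg : ∀ n (g : ℕ → ℤ) → sumTo n (λ j → - g j) ≡ - sumTo n g
sumTo-neg zero g = refl
sumTo-neg (suc n) g rewrite sumTo-neg n g = sym (ℤ.neg-distrib-+ (sumTo n g) (g (suc n)))

sumTo-suc : ∀ n (g : ℕ → ℤ) → sumTo (suc n) g ≡ g 0 +ℤ sumTo n (λ j → g (suc j))
sumTo-suc zero g = refl
sumTo-suc (suc n) g rewrite sumTo-suc n g = ℤ.+-assoc (g 0) _ _

sumTo-reverse : ∀ n (g : ℕ → ℤ) → sumTo n g ≡ sumTo n (λ j → g (n ∸ j))
sumTo-reverse zero g = refl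
sumTo-reverse (suc n) g = begin
  sumTo (suc n) g                                   ≡⟨ sumTo-suc n g ⟩
  g 0 +ℤ sumTo n (λ j → g (suc j))                  ≡⟨ cong (g 0 +ℤ_) (sumTo-reverse n (λ j → g (suc j))) ⟩
  g 0 +ℤ sumTo n (λ j → g (suc (n ∸ j)))            ≡⟨ ℤ.+-comm (g 0) _ ⟩
  sumTo n (λ j → g (suc (n ∸ j))) +ℤ g 0
    ≡⟨ cong₂ _+ℤ_ (sumTo-cong n (λ j j≤n → cong g (sym (ℕ.+-∸-assoc 1 j≤n)))) (cong g (sym (ℕ.n∸n≡0 n))) ⟩
  sumTo (suc n) (λ j → g (suc n ∸ j))               ∎

i≡-i⇒i≡0 : ∀ i → i ≡ - i → i ≡ +0
i≡-i⇒i≡0 +0 _ = refl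
i≡-i⇒i≡0 +[1+ m ] ()
i≡-i⇒i≡0 -[1+ m ] ()

0<p*x⇒0<p*y⇒0<p*[x+y] : ∀ p x y → +0 <ℤ p *ℤ x → +0 <ℤ p *ℤ y → +0 <ℤ p *ℤ (x +ℤ y)
0<p*x⇒0<p*y⇒0<p*[x+y] p x y 0<px 0<py rewrite ℤ.*-distribˡ-+ p x y = ℤ.+-mono-< 0<px 0<py

binomialSum : (ℕ → ℤ) → ℕ → ℕ → ℤ
binomialSum s n t = sumTo n (λ j → + (n C j) *ℤ s (j + t))

binomialSum-suc : ∀ s n t → binomialSum s (suc n) t ≡ binomialSum s n t +ℤ binomialSum s n (suc t)
binomialSum-suc s n t = begin
  binomialSum s (suc n) t                               ≡⟨ sumTo-suc n _ ⟩
  + 1 *ℤ s t +ℤ sumTo n (λ j → + (suc n C suc j) *ℤ s (suc j + t))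
    ≡⟨ cong (+ 1 *ℤ s t +ℤ_) (trans (sumTo-cong n (λ j _ → pascal-term j)) (sumTo-+ n _ _)) ⟩
  + 1 *ℤ s t +ℤ (binomialSum s n (suc t) +ℤ upper)     ≡⟨ ℤ+.x∙yz≈y∙xz (+ 1 *ℤ s t) (binomialSum s n (suc t)) upper ⟩
  binomialSum s n (suc t) +ℤ (+ 1 *ℤ s t +ℤ upper)     ≡⟨ cong (binomialSum s n (suc t) +ℤ_) lower ⟩
  binomialSum s n (suc t) +ℤ binomialSum s n t          ≡⟨ ℤ.+-comm (binomialSum s n (suc t)) _ ⟩
  binomialSum s n t +ℤ binomialSum s n (suc t)          ∎
  where
  upper : ℤ
  upper = sumTo n (λ j → + (n C suc j) *ℤ s (suc j + t))
  pascal-term : ∀ j → + (suc n C suc j) *ℤ s (suc j + t) ≡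
                      + (n C j) *ℤ s (j + suc t) +ℤ + (n C suc j) *ℤ s (suc j + t)
  pascal-term j rewrite pascal n j | ℤ.pos-+ (n C j) (n C suc j) | ℕ.+-suc j t =
    ℤ.*-distribʳ-+ (s (suc (j + t))) (+ (n C j)) (+ (n C suc j))
  lower : + 1 *ℤ s t +ℤ upper ≡ binomialSum s n t
  lower = begin
    + 1 *ℤ s t +ℤ upper                                            ≡⟨ sumTo-suc n _ ⟨
    binomialSum s n t +ℤ + (n C suc n) *ℤ s (suc n + t)
      ≡⟨ cong (λ c → binomialSum s n t +ℤ + c *ℤ s (suc n + t)) (k>n⇒nCk≡0 (ℕ.n<1+n n)) ⟩
    binomialSum s n t +ℤ +0                                        ≡⟨ ℤ.+-identityʳ _ ⟩
    binomialSum s n t                                              ∎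

binomialSum-antisym : ∀ s n t → (∀ x y → x + y ≡ n + (t + t) → s x ≡ - s y) → binomialSum s n t ≡ +0
binomialSum-antisym s n t antisym = i≡-i⇒i≡0 _ (begin
  binomialSum s n t                                    ≡⟨ sumTo-reverse n _ ⟩
  sumTo n (λ j → + (n C (n ∸ j)) *ℤ s (n ∸ j + t))     ≡⟨ sumTo-cong n reflect ⟩
  sumTo n (λ j → - (+ (n C j) *ℤ s (j + t)))           ≡⟨ sumTo-neg n _ ⟩
  - binomialSum s n t                                  ∎)
  where
  reflect : ∀ j → j ≤ n → + (n C (n ∸ j)) *ℤ s (n ∸ j + t) ≡ - (+ (n C j) *ℤ s (j + t))
  reflect j j≤n = begin
    + (n C (n ∸ j)) *ℤ s (n ∸ j + t)     ≡⟨ cong₂ (λ c v → + c *ℤ v) (sym (nCk≡nC[n∸k] j≤n)) (antisym _ _ arguments-sum) ⟩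
    + (n C j) *ℤ - s (j + t)             ≡⟨ ℤ.neg-distribʳ-* (+ (n C j)) (s (j + t)) ⟨
    - (+ (n C j) *ℤ s (j + t))           ∎
    where
    regroup : ∀ a j t → a + t + (j + t) ≡ (a + j) + (t + t)
    regroup = ℕ-Solver.solve-∀
    arguments-sum : (n ∸ j + t) + (j + t) ≡ n + (t + t)
    arguments-sum = trans (regroup (n ∸ j) j t) (cong (_+ (t + t)) (ℕ.m∸n+n≡m j≤n))

centre : ℕ → ℕ → ℕ
centre n t = suc (n + (t + t))

centre-suc : ∀ n t → centre n (suc t) ≡ suc (suc (centre n t))
centre-suc n t = shift n t
  where
  shift : ∀ n t → suc (n + (suc t + suc t)) ≡ suc (suc (suc (n + (t + t))))
  shift = ℕ-Solver.solve-∀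

2^[1+k]∤2+ : ∀ k c → 1 ≤ k → 2 ^ suc k ∣ c → 2 ^ suc k ∤ suc (suc c)
2^[1+k]∤2+ k c k≥1 ∣c ∣c+2 =
  >⇒∤ (ℕ.^-monoʳ-< 2 (s≤s (s≤s z≤n)) (s≤s k≥1)) (∣m+n∣m⇒∣n (subst (2 ^ suc k ∣_) (ℕ.+-comm 2 c) ∣c+2) ∣c)

binomialSum-digitSign-vanishes : ∀ k n t → 2 ^ suc k ∣ centre n t → binomialSum (digitSign k) n t ≡ +0
binomialSum-digitSign-vanishes k n t ∣c = binomialSum-antisym (digitSign k) n t λ x y x+y≡ →
  digitSign-complement k x y (subst (λ m → 2 ^ suc k ∣ suc m) (sym x+y≡) ∣c)

binomialSum-digitSign-sign : ∀ k → 1 ≤ k → ∀ n t → 2 ^ suc k ∤ centre n t →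
                +0 <ℤ digitSign (suc k) (centre n t) *ℤ binomialSum (digitSign k) n t
binomialSum-digitSign-sign k _ zero t _ rewrite ⌊1+a+a/2⌋≡a t | ℤ.*-identityˡ (digitSign k t) | digitSign-*-digitSign k t =
  +<+ (s≤s z≤n)
binomialSum-digitSign-sign k k≥1 (suc n) t ∤c+1 =
  subst (λ v → +0 <ℤ σ (suc c) *ℤ v) (sym (binomialSum-suc (digitSign k) n t))
        (combine (2 ^ suc k ∣? c) (2 ^ suc k ∣? suc (suc c)))
  where
  σ : ℕ → ℤ
  σ = digitSign (suc k)
  c : ℕ
  c = centre n t
  left : 2 ^ suc k ∤ c → +0 <ℤ σ (suc c) *ℤ binomialSum (digitSign k) n t
  left ∤c = subst (λ u → +0 <ℤ u *ℤ binomialSum (digitSign k) n t)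
                  (sym (digitSign-suc (suc k) c ∤c+1))
                  (binomialSum-digitSign-sign k k≥1 n t ∤c)
  right : 2 ^ suc k ∤ suc (suc c) → +0 <ℤ σ (suc c) *ℤ binomialSum (digitSign k) n (suc t)
  right ∤c+2 = subst (λ u → +0 <ℤ u *ℤ binomialSum (digitSign k) n (suc t))
                     (trans (cong σ (centre-suc n t)) (digitSign-suc (suc k) (suc c) ∤c+2))
                     (binomialSum-digitSign-sign k k≥1 n (suc t) (λ d → ∤c+2 (subst (2 ^ suc k ∣_) (centre-suc n t) d)))
  combine : Dec (2 ^ suc k ∣ c) → Dec (2 ^ suc k ∣ suc (suc c)) →
            +0 <ℤ σ (suc c) *ℤ (binomialSum (digitSign k) n t +ℤ binomialSum (digitSign k) n (suc t))
  combine (yes ∣c) (yes ∣c+2) = contradiction ∣c+2 (2^[1+k]∤2+ k c k≥1 ∣c)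
  combine (yes ∣c) (no ∤c+2)
    rewrite binomialSum-digitSign-vanishes k n t ∣c | ℤ.+-identityˡ (binomialSum (digitSign k) n (suc t)) = right ∤c+2
  combine (no ∤c) (yes ∣c+2)
    rewrite binomialSum-digitSign-vanishes k n (suc t) (subst (2 ^ suc k ∣_) (sym (centre-suc n t)) ∣c+2)
          | ℤ.+-identityʳ (binomialSum (digitSign k) n t) = left ∤c
  combine (no ∤c) (no ∤c+2) = 0<p*x⇒0<p*y⇒0<p*[x+y] (σ (suc c)) _ _ (left ∤c) (right ∤c+2)

f2k≡binomialSum-digitSign : ∀ k n → f2k k n ≡ binomialSum (digitSign k) n 0
f2k≡binomialSum-digitSign k n = sumTo-cong n λ j _ →
  cong (_*ℤ_ (+ (n C j))) (trans (sgn-C-2^ k j) (cong (digitSign k) (sym (ℕ.+-identityʳ j))))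

f2k-sign : ∀ k n → 1 ≤ k → 2 ^ suc k ∤ suc n → +0 <ℤ digitSign (suc k) (suc n) *ℤ f2k k n
f2k-sign k n k≥1 ∤ =
  subst₂ (λ u v → +0 <ℤ u *ℤ v) (cong (digitSign (suc k)) centre≡) (sym (f2k≡binomialSum-digitSign k n))
         (binomialSum-digitSign-sign k k≥1 n 0 (λ d → ∤ (subst (2 ^ suc k ∣_) centre≡ d)))
  where
  centre≡ : centre n 0 ≡ suc n
  centre≡ = cong suc (ℕ.+-identityʳ n)

0<sgnν*f2k : ∀ k ν r → 1 ≤ k → 1 ≤ r → r < 2 ^ suc k → +0 <ℤ sgn ν *ℤ f2k k (ν * 2 ^ suc k + r ∸ 1)
0<sgnν*f2k k ν r k≥1 r≥1 r<N =
  subst (λ u → +0 <ℤ u *ℤ f2k k (m ∸ 1))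
        (trans (cong (digitSign (suc k)) 1+[m∸1]≡m) (digitSign-high (suc k) ν r r<N))
        (f2k-sign k (m ∸ 1) k≥1 (λ d → N∤m (subst (2 ^ suc k ∣_) 1+[m∸1]≡m d)))
  where
  m : ℕ
  m = ν * 2 ^ suc k + r
  1≤m : 1 ≤ m
  1≤m = ℕ.≤-trans r≥1 (ℕ.m≤n+m r (ν * 2 ^ suc k))
  1+[m∸1]≡m : suc (m ∸ 1) ≡ m
  1+[m∸1]≡m = ℕ.suc-pred m {{>-nonZero 1≤m}}
  N∤m : 2 ^ suc k ∤ m
  N∤m d = ℕ.<⇒≱ r<N (∣⇒≤ {{>-nonZero r≥1}} (∣m+n∣m⇒∣n d (n∣m*n ν)))

corollary5p5 : (k r : ℕ) → 1 ≤ k → 1 ≤ r → r ≤ 2 ^ (k + 1) ∸ 1 →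
    (ν : ℕ) → 2 ^ (3 * k) ≤ 17 * ν →
    +0 <ℤ sgn ν *ℤ f2k k (ν * 2 ^ (k + 1) + r ∸ 1)
corollary5p5 k r k≥1 r≥1 r≤ ν _ =
  subst (λ e → +0 <ℤ sgn ν *ℤ f2k k (ν * 2 ^ e + r ∸ 1)) (ℕ.+-comm 1 k)
        (0<sgnν*f2k k ν r k≥1 r≥1 r<N)
  where
  r<N : r < 2 ^ suc k
  r<N = subst (r <_) (cong (2 ^_) (ℕ.+-comm k 1)) (ℕ.m≤pred[n]⇒suc[m]≤n {{ℕ.m^n≢0 2 (k + 1)}} r≤)
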